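{- Let $q$ be a prime power, $Q^+(7,q)$ a non-degenerate hyperbolic quadric of ${\rm PG}(7,q)$, and $\Pi$ a fixed generator of it. Let $\mathcal G_3$ be the graph with vertex set $Q^+(7,q)\setminus\Pi$ where distinct vertices $P_1,P_2$ are adjacent iff $P_1\sim_1P_2$ or $P_1\sim_2P_2$, with $P_1\sim_1 P_2$ meaning the line $\langle P_1,P_2\rangle$ is secant to $Q^+(7,q)$, and $P_1\sim_2P_2$ meaning $\langle P_1,P_2\rangle$ is contained in $Q^+(7,q)$ and meets $\Pi$ in a point. If $\mathcal C=\{P,Q,R\}$ is a clique of mixed type in $\mathcal G_3$, then among the three pairs of vertices of $\mathcal C$ exactly two are in relation $\sim_1$ and exactly one is in relation $\sim_2$, and $\mathcal C$ spans a plane meeting $\Pi$ in exactly one point.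
   Context: A generator of $Q^+(7,q)$ is a solid contained in the quadric. A clique of $\mathcal G_3$ is of type 1 (resp. type 2) if all pairs of its vertices are in relation $\sim_1$ (resp. $\sim_2$); otherwise it is of mixed type. -}

module Defs where

open import Level using (Level; _⊔_) renaming (suc to lsuc)
open import Data.Nat using (ℕ) renaming (suc to sucℕ; _^_ to _^ℕ_)
open import Data.Nat.Primality using (Prime)
open import Data.Fin using (Fin; zero; suc; #_)
open import Data.Product using (Σ; ∃; _×_; _,_)
open import Data.Sum using (_⊎_)
open import Relation.Nullary using (¬_)
open import Relation.Binary.PropositionalEquality using (_≡_)
open import Algebra.Bundles using (CommutativeRing)

IsPrimePower : ℕ → Set
IsPrimePower q = Σ ℕ λ p → Σ ℕ λ k → Prime p × q ≡ p ^ℕ sucℕ k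

record Field (c ℓ : Level) : Set (lsuc (c ⊔ ℓ)) where
  field
    commRing : CommutativeRing c ℓ
  open CommutativeRing commRing public
  field
    1≉0     : ¬ (1# ≈ 0#)
    inverse : ∀ x → ¬ (x ≈ 0#) → Σ Carrier λ y → x * y ≈ 1#

record HasOrder {c ℓ} (F : Field c ℓ) (q : ℕ) : Set (c ⊔ ℓ) where
  open Field F using (Carrier; _≈_; _+_; _*_; 0#; 1#)
  field
    enum     : Fin q → Carrier
    enum-inj : ∀ i j → enum i ≈ enum j → i ≡ j
    enum-sur : ∀ x → Σ (Fin q) λ i → enum i ≈ x

module Geometry {c ℓ} (F : Field c ℓ) where
  open Field F using (Carrier; _≈_; _+_; _*_; 0#; 1#)

  -- Vectors of the underlying vector space F^8 of PG(7,q).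
  V : Set c
  V = Fin 8 → Carrier

  _+ᵥ_ : V → V → V
  (u +ᵥ v) i = u i + v i

  _·_ : Carrier → V → V
  (a · v) i = a * v i

  NonZero : V → Set ℓ
  NonZero v = ¬ (∀ i → v i ≈ 0#)

  -- Two nonzero vectors represent the same projective point.
  SamePoint : V → V → Set (c ⊔ ℓ)
  SamePoint u v = Σ Carrier λ a → ∀ i → v i ≈ a * u i

  -- The standard non-degenerate hyperbolic quadric Q⁺(7,q):
  -- x0 x1 + x2 x3 + x4 x5 + x6 x7 = 0.
  Qf : V → Carrier
  Qf x = x (# 0) * x (# 1) + (x (# 2) * x (# 3) + (x (# 4) * x (# 5) + x (# 6) * x (# 7)))

  OnQ : V → Set ℓ
  OnQ x = Qf x ≈ 0#

  lin : ∀ {n} → (Fin n → Carrier) → (Fin n → V) → V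
  lin {ℕ.zero} c b = λ _ → 0#
  lin {sucℕ n} c b = (c zero · b zero) +ᵥ lin (λ i → c (suc i)) (λ i → b (suc i))

  InSpan : ∀ {n} → (Fin n → V) → V → Set (c ⊔ ℓ)
  InSpan {n} b v = Σ (Fin n → Carrier) λ a → ∀ i → v i ≈ lin a b i

  LinIndep : ∀ {n} → (Fin n → V) → Set (c ⊔ ℓ)
  LinIndep {n} b = ∀ (a : Fin n → Carrier) → (∀ i → lin a b i ≈ 0#) → ∀ j → a j ≈ 0#

  -- A generator of Q⁺(7,q): a solid (projective 3-space, i.e. a 4-dimensional
  -- vector subspace, given by a basis) contained in the quadric.
  record Generator : Set (c ⊔ ℓ) where
    field
      basis     : Fin 4 → V
      indep     : LinIndep basis
      contained : ∀ v → InSpan basis v → OnQ v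

  pair : V → V → Fin 2 → V
  pair u v zero = u
  pair u v (suc zero) = v

  triple : V → V → V → Fin 3 → V
  triple u v w zero = u
  triple u v w (suc zero) = v
  triple u v w (suc (suc zero)) = w

  PointIn : ∀ {n} → (Fin n → V) → V → Set (c ⊔ ℓ)
  PointIn b x = NonZero x × InSpan b x

  MeetsQInTwoPoints : ∀ {n} → (Fin n → V) → Set (c ⊔ ℓ)
  MeetsQInTwoPoints b =
    Σ V λ X → Σ V λ Y →
      PointIn b X × OnQ X × PointIn b Y × OnQ Y × ¬ SamePoint X Y ×
      (∀ Z → PointIn b Z → OnQ Z → SamePoint X Z ⊎ SamePoint Y Z)

  MeetsInOnePoint : ∀ {n m} → (Fin n → V) → (Fin m → V) → Set (c ⊔ ℓ)
  MeetsInOnePoint b b' =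
    Σ V λ X → PointIn b X × InSpan b' X ×
      (∀ Z → PointIn b Z → InSpan b' Z → SamePoint X Z)

  module _ (Π : Generator) where
    open Generator Π

    Vertex : V → Set (c ⊔ ℓ)
    Vertex x = NonZero x × OnQ x × ¬ InSpan basis x

    _∼₁_ : V → V → Set (c ⊔ ℓ)
    P₁ ∼₁ P₂ = MeetsQInTwoPoints (pair P₁ P₂)

    _∼₂_ : V → V → Set (c ⊔ ℓ)
    P₁ ∼₂ P₂ = (∀ v → InSpan (pair P₁ P₂) v → OnQ v) × MeetsInOnePoint (pair P₁ P₂) basis

    Adjacent : V → V → Set (c ⊔ ℓ)
    Adjacent P₁ P₂ = ¬ SamePoint P₁ P₂ × (P₁ ∼₁ P₂ ⊎ P₁ ∼₂ P₂)

    Clique3 : V → V → V → Set (c ⊔ ℓ)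
    Clique3 P Q R = Vertex P × Vertex Q × Vertex R ×
                    Adjacent P Q × Adjacent P R × Adjacent Q R

    MixedType : V → V → V → Set (c ⊔ ℓ)
    MixedType P Q R = ¬ (P ∼₁ Q × P ∼₁ R × Q ∼₁ R) × ¬ (P ∼₂ Q × P ∼₂ R × Q ∼₂ R)

    Only₁ : V → V → Set (c ⊔ ℓ)
    Only₁ A B = A ∼₁ B × ¬ A ∼₂ B

    Only₂ : V → V → Set (c ⊔ ℓ)
    Only₂ A B = A ∼₂ B × ¬ A ∼₁ B

    TwoOneSplit : V → V → V → Set (c ⊔ ℓ)
    TwoOneSplit P Q R =
        (Only₂ P Q × Only₁ P R × Only₁ Q R)
      ⊎ (Only₁ P Q × Only₂ P R × Only₁ Q R)
      ⊎ (Only₁ P Q × Only₁ P R × Only₂ Q R)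

    PlaneMeetingΠInPoint : V → V → V → Set (c ⊔ ℓ)
    PlaneMeetingΠInPoint P Q R =
      LinIndep (triple P Q R) × MeetsInOnePoint (triple P Q R) basis

{-# OPTIONS --safe #-}
-- Let B be the polar form of the quadric. For singular points P, Q the line PQ is secant exactly when
-- B(P,Q) ≠ 0, whereas P ∼₂ Q makes PQ totally singular, so B(P,Q) = 0 and no pair is in both relations.
-- If X ∉ Π and X ∼₂ Y, X ∼₂ Z, the lines XY and XZ meet Π in A = a₀X + a₁Y and A' = b₀X + b₁Z with
-- a₁, b₁ ≠ 0; since Π is totally singular, 0 = B(A,A') = a₁b₁B(Y,Z), so Y ≁₁ Z. Hence a mixed clique has
-- exactly one ∼₂ pair, say X ∼₂ Y, and then X ∼₁ Z. Pairing a vanishing combination of X, Y, Z with X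
-- kills its Z-coefficient, so X, Y, Z are independent; their plane meets Π in A, and a point of Π in the
-- plane with nonzero Z-coefficient would force Z ∈ Π.
module Submission where

open import Defs
open import Level using (Level; _⊔_)
open import Data.Nat using (ℕ)
open import Data.Fin using (Fin; zero; suc; #_)
open import Data.Fin.Patterns using (0F; 1F; 2F)
open import Data.Fin.Permutation using (Permutation′; _⟨$⟩ʳ_; _⟨$⟩ˡ_; inverseˡ; transpose; _∘ₚ_)
open import Data.Fin.Properties using () renaming (_≟_ to _≟ᶠ_)
open import Data.Product using (Σ; _×_; _,_; proj₁; proj₂; map)
open import Data.Sum using (inj₁; inj₂; [_,_]′)
open import Data.Empty using (⊥-elim)
open import Data.Vec.Functional using ([]; _∷_)
open import Function using (_∘_)
open import Relation.Binary.Definitions using (Decidable)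
import Relation.Binary.PropositionalEquality as ≡
open ≡ using (_≡_)
open import Relation.Nullary using (¬_)
open import Relation.Nullary.Decidable using (map′; decidable-stable)

HasOrder⇒≈-decidable : ∀ {c ℓ} {F : Field c ℓ} {q} → HasOrder F q → Decidable (Field._≈_ F)
HasOrder⇒≈-decidable {F = F} order x y =
  map′ (λ i≡j → trans (sym i↦x) (trans (reflexive (≡.cong enum i≡j)) j↦y))
       (λ x≈y → enum-inj i j (trans i↦x (trans x≈y (sym j↦y))))
       (i ≟ᶠ j)
  where
  open Field F hiding (zero)
  open HasOrder order
  i = proj₁ (enum-sur x)
  i↦x = proj₂ (enum-sur x)
  j = proj₁ (enum-sur y)
  j↦y = proj₂ (enum-sur y)

module FieldProperties {c ℓ} (F : Field c ℓ) where
  open Field F hiding (zero)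
  open import Relation.Binary.Reasoning.Setoid setoid
  open import Algebra.Properties.Ring ring using (-1*x≈-x)
  open import Algebra.Properties.AbelianGroup +-abelianGroup using (xyx⁻¹≈y)

  inverse-cancel : ∀ {x} → ¬ x ≈ 0# → Σ Carrier λ x⁻¹ → ∀ y → x⁻¹ * (x * y) ≈ y
  inverse-cancel {x} x≉0 = x⁻¹ , λ y → begin
    x⁻¹ * (x * y) ≈⟨ *-assoc x⁻¹ x y ⟨
    x⁻¹ * x * y   ≈⟨ *-congʳ (trans (*-comm x⁻¹ x) xx⁻¹≈1) ⟩
    1# * y        ≈⟨ *-identityˡ y ⟩
    y             ∎
    where
    x⁻¹ = proj₁ (inverse x x≉0)
    xx⁻¹≈1 = proj₂ (inverse x x≉0)

  x≈0⇒y*x≈0 : ∀ {x y} → x ≈ 0# → y * x ≈ 0#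
  x≈0⇒y*x≈0 {y = y} x≈0 = trans (*-congˡ x≈0) (zeroʳ y)

  x≈0⇒x*y≈0 : ∀ {x y} → x ≈ 0# → x * y ≈ 0#
  x≈0⇒x*y≈0 {y = y} x≈0 = trans (*-congʳ x≈0) (zeroˡ y)

  x≈0⇒x+y≈y : ∀ {x y} → x ≈ 0# → x + y ≈ y
  x≈0⇒x+y≈y {y = y} x≈0 = trans (+-congʳ x≈0) (+-identityˡ y)

  x*y≈0⇒y≈0 : ∀ {x y} → ¬ x ≈ 0# → x * y ≈ 0# → y ≈ 0#
  x*y≈0⇒y≈0 {x} {y} x≉0 xy≈0 = begin
    y             ≈⟨ proj₂ (inverse-cancel x≉0) y ⟨
    _ * (x * y)   ≈⟨ *-congˡ xy≈0 ⟩
    _ * 0#        ≈⟨ zeroʳ _ ⟩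
    0#            ∎

  x*y≈0⇒x≈0 : ∀ {x y} → ¬ y ≈ 0# → x * y ≈ 0# → x ≈ 0#
  x*y≈0⇒x≈0 {x} {y} y≉0 xy≈0 = x*y≈0⇒y≈0 y≉0 (trans (*-comm y x) xy≈0)

  x≉0∧y≉0⇒x*y≉0 : ∀ {x y} → ¬ x ≈ 0# → ¬ y ≈ 0# → ¬ x * y ≈ 0#
  x≉0∧y≉0⇒x*y≉0 x≉0 y≉0 xy≈0 = y≉0 (x*y≈0⇒y≈0 x≉0 xy≈0)

  x+y≈k*x⇒y≈[k-1]*x : ∀ {x y k} → x + y ≈ k * x → y ≈ (k - 1#) * x
  x+y≈k*x⇒y≈[k-1]*x {x} {y} {k} x+y≈kx = begin
    y                ≈⟨ xyx⁻¹≈y x y ⟨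
    x + y - x        ≈⟨ +-congʳ x+y≈kx ⟩
    k * x + - x      ≈⟨ +-congˡ (-1*x≈-x x) ⟨
    k * x + - 1# * x ≈⟨ distribʳ x k (- 1#) ⟨
    (k - 1#) * x     ∎

module VectorProperties {c ℓ} (F : Field c ℓ) where
  open Field F hiding (zero)
  open Geometry F
  open FieldProperties F
  open import Algebra.Properties.Semiring.Sum semiring
    using (sum; sum-cong-≋; sum-cong-≗; ∑-distrib-+; *-distribˡ-sum; sum-permute)
  open import Relation.Binary.Reasoning.Setoid setoid

  infix 4 _≈ᵥ_
  _≈ᵥ_ : V → V → Set ℓ
  u ≈ᵥ v = ∀ i → u i ≈ v i

  TotallySingular : ∀ {n} → (Fin n → V) → Set (c ⊔ ℓ)
  TotallySingular b = ∀ v → InSpan b v → OnQ v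

  lin≡sum : ∀ {n} (a : Fin n → Carrier) (b : Fin n → V) i → lin a b i ≡ sum (λ j → a j * b j i)
  lin≡sum {ℕ.zero}  a b i = ≡.refl
  lin≡sum {ℕ.suc n} a b i = ≡.cong (a zero * b zero i +_) (lin≡sum (a ∘ suc) (b ∘ suc) i)

  lin-pair : ∀ a X Y → lin a (pair X Y) ≈ᵥ (a 0F · X) +ᵥ (a 1F · Y)
  lin-pair a X Y i = +-congˡ (+-identityʳ _)

  lin-triple : ∀ a X Y Z → lin a (triple X Y Z) ≈ᵥ (a 0F · X) +ᵥ ((a 1F · Y) +ᵥ (a 2F · Z))
  lin-triple a X Y Z i = +-congˡ (+-congˡ (+-identityʳ _))

  InSpan-pair : ∀ {X Y} α β → InSpan (pair X Y) ((α · X) +ᵥ (β · Y))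
  InSpan-pair {X} {Y} α β = (α ∷ β ∷ []) , λ i → sym (lin-pair (α ∷ β ∷ []) X Y i)

  module _ {n} {b : Fin n → V} where

    lin-+ : ∀ a a' i → lin a b i + lin a' b i ≈ lin (λ j → a j + a' j) b i
    lin-+ a a' i = begin
      lin a b i + lin a' b i
        ≡⟨ ≡.cong₂ _+_ (lin≡sum a b i) (lin≡sum a' b i) ⟩
      sum (λ j → a j * b j i) + sum (λ j → a' j * b j i)
        ≈⟨ ∑-distrib-+ (λ j → a j * b j i) (λ j → a' j * b j i) ⟨
      sum (λ j → a j * b j i + a' j * b j i)
        ≈⟨ sum-cong-≋ (λ j → sym (distribʳ (b j i) (a j) (a' j))) ⟩
      sum (λ j → (a j + a' j) * b j i)
        ≡⟨ lin≡sum (λ j → a j + a' j) b i ⟨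
      lin (λ j → a j + a' j) b i ∎

    lin-· : ∀ k a i → k * lin a b i ≈ lin (λ j → k * a j) b i
    lin-· k a i = begin
      k * lin a b i                ≡⟨ ≡.cong (k *_) (lin≡sum a b i) ⟩
      k * sum (λ j → a j * b j i)  ≈⟨ *-distribˡ-sum k (λ j → a j * b j i) ⟩
      sum (λ j → k * (a j * b j i)) ≈⟨ sum-cong-≋ (λ j → sym (*-assoc k (a j) (b j i))) ⟩
      sum (λ j → k * a j * b j i)  ≡⟨ lin≡sum (λ j → k * a j) b i ⟨
      lin (λ j → k * a j) b i      ∎

    InSpan-resp : ∀ {u v} → u ≈ᵥ v → InSpan b u → InSpan b v
    InSpan-resp u≈v (a , u≈lin) = a , λ i → trans (sym (u≈v i)) (u≈lin i)

    InSpan-+ : ∀ {u v} → InSpan b u → InSpan b v → InSpan b (u +ᵥ v)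
    InSpan-+ (a , u≈lin) (a' , v≈lin) =
      (λ j → a j + a' j) , λ i → trans (+-cong (u≈lin i) (v≈lin i)) (lin-+ a a' i)

    InSpan-· : ∀ {u} k → InSpan b u → InSpan b (k · u)
    InSpan-· k (a , u≈lin) = (λ j → k * a j) , λ i → trans (*-congˡ (u≈lin i)) (lin-· k a i)

    InSpan-unscale : ∀ {u k} → ¬ k ≈ 0# → InSpan b (k · u) → InSpan b u
    InSpan-unscale {u} {k} k≉0 ku∈b =
      InSpan-resp (proj₂ (inverse-cancel k≉0) ∘ u) (InSpan-· (proj₁ (inverse-cancel k≉0)) ku∈b)

    module _ (π : Permutation′ n) where

      lin-permute : ∀ a i → lin a b i ≈ lin (a ∘ (π ⟨$⟩ʳ_)) (b ∘ (π ⟨$⟩ʳ_)) i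
      lin-permute a i = begin
        lin a b i                                     ≡⟨ lin≡sum a b i ⟩
        sum (λ j → a j * b j i)                       ≈⟨ sum-permute (λ j → a j * b j i) π ⟩
        sum (λ j → a (π ⟨$⟩ʳ j) * b (π ⟨$⟩ʳ j) i)     ≡⟨ lin≡sum (a ∘ (π ⟨$⟩ʳ_)) (b ∘ (π ⟨$⟩ʳ_)) i ⟨
        lin (a ∘ (π ⟨$⟩ʳ_)) (b ∘ (π ⟨$⟩ʳ_)) i         ∎

      lin-unpermute : ∀ a i → lin (a ∘ (π ⟨$⟩ˡ_)) b i ≈ lin a (b ∘ (π ⟨$⟩ʳ_)) i
      lin-unpermute a i = begin
        lin (a ∘ (π ⟨$⟩ˡ_)) b i
          ≈⟨ lin-permute (a ∘ (π ⟨$⟩ˡ_)) i ⟩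
        lin (λ j → a (π ⟨$⟩ˡ (π ⟨$⟩ʳ j))) (b ∘ (π ⟨$⟩ʳ_)) i
          ≡⟨ lin≡sum _ (b ∘ (π ⟨$⟩ʳ_)) i ⟩
        sum (λ j → a (π ⟨$⟩ˡ (π ⟨$⟩ʳ j)) * b (π ⟨$⟩ʳ j) i)
          ≡⟨ sum-cong-≗ (λ j → ≡.cong (λ k → a k * b (π ⟨$⟩ʳ j) i) (inverseˡ π)) ⟩
        sum (λ j → a j * b (π ⟨$⟩ʳ j) i)
          ≡⟨ lin≡sum a (b ∘ (π ⟨$⟩ʳ_)) i ⟨
        lin a (b ∘ (π ⟨$⟩ʳ_)) i ∎

      InSpan-permute : ∀ {v} → InSpan b v → InSpan (b ∘ (π ⟨$⟩ʳ_)) v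
      InSpan-permute (a , v≈lin) = a ∘ (π ⟨$⟩ʳ_) , λ i → trans (v≈lin i) (lin-permute a i)

      InSpan-unpermute : ∀ {v} → InSpan (b ∘ (π ⟨$⟩ʳ_)) v → InSpan b v
      InSpan-unpermute (a , v≈lin) = a ∘ (π ⟨$⟩ˡ_) , λ i → trans (v≈lin i) (sym (lin-unpermute a i))

      LinIndep-permute : LinIndep b → LinIndep (b ∘ (π ⟨$⟩ʳ_))
      LinIndep-permute indep a lin≈0 j = begin
        a j                     ≡⟨ ≡.cong a (inverseˡ π) ⟨
        a (π ⟨$⟩ˡ (π ⟨$⟩ʳ j))   ≈⟨ indep (a ∘ (π ⟨$⟩ˡ_)) (λ i → trans (lin-unpermute a i) (lin≈0 i))
                                         (π ⟨$⟩ʳ j) ⟩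
        0#                      ∎

      MeetsInOnePoint-permute : ∀ {m} {c : Fin m → V} →
                                MeetsInOnePoint b c → MeetsInOnePoint (b ∘ (π ⟨$⟩ʳ_)) c
      MeetsInOnePoint-permute (X , (X≢0 , X∈b) , X∈c , unique) =
        X , (X≢0 , InSpan-permute X∈b) , X∈c ,
        λ Z (Z≢0 , Z∈bπ) Z∈c → unique Z (Z≢0 , InSpan-unpermute Z∈bπ) Z∈c

      TotallySingular-permute : TotallySingular b → TotallySingular (b ∘ (π ⟨$⟩ʳ_))
      TotallySingular-permute singular v v∈bπ = singular v (InSpan-unpermute v∈bπ)

  SamePoint-sym : ∀ {u v} → NonZero v → SamePoint u v → SamePoint v u
  SamePoint-sym {u} {v} v≢0 (k , v≈ku) = k⁻¹ , λ i → trans (sym (k⁻¹-cancel (u i))) (*-congˡ (sym (v≈ku i)))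
    where
    k≉0 : ¬ k ≈ 0#
    k≉0 k≈0 = v≢0 λ i → trans (v≈ku i) (trans (*-congʳ k≈0) (zeroˡ (u i)))
    k⁻¹ = proj₁ (inverse-cancel k≉0)
    k⁻¹-cancel = proj₂ (inverse-cancel k≉0)

  X+Y≈kX⇒SamePoint : ∀ {X Y k} → (X +ᵥ Y) ≈ᵥ (k · X) → SamePoint X Y
  X+Y≈kX⇒SamePoint {k = k} X+Y≈kX = k - 1# , λ i → x+y≈k*x⇒y≈[k-1]*x (X+Y≈kX i)

  InSpan-combination⇒coefficient≉0 : ∀ {n} {b : Fin n → V} {X Y A α β} →
    ¬ InSpan b X → NonZero A → InSpan b A → A ≈ᵥ (α · X) +ᵥ (β · Y) → ¬ β ≈ 0#
  InSpan-combination⇒coefficient≉0 {X = X} {Y} {A} {α} X∉b A≢0 A∈b A≈αX+βY β≈0 =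
    X∉b (InSpan-unscale α≉0 (InSpan-resp A≈αX A∈b))
    where
    A≈αX : A ≈ᵥ α · X
    A≈αX i = trans (A≈αX+βY i) (trans (+-congˡ (trans (*-congʳ β≈0) (zeroˡ (Y i)))) (+-identityʳ _))
    α≉0 : ¬ α ≈ 0#
    α≉0 α≈0 = A≢0 λ i → trans (A≈αX i) (trans (*-congʳ α≈0) (zeroˡ (X i)))

module PolarForm {c ℓ} (F : Field c ℓ) where
  open Field F hiding (zero)
  open Geometry F
  open FieldProperties F
  open VectorProperties F
  open import Algebra.Properties.CommutativeSemigroup +-commutativeSemigroup using (interchange)
  open import Algebra.Solver.Ring.NaturalCoefficients.Default commutativeSemiring
  open import Relation.Binary.Reasoning.Setoid setoid

  -- Qf x is pairSum (λ i j → x i * x j) by definition, so each identity below reduces to one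
  -- hyperbolic pair of coordinates.
  pairSum : (Fin 8 → Fin 8 → Carrier) → Carrier
  pairSum t = t (# 0) (# 1) + (t (# 2) (# 3) + (t (# 4) (# 5) + t (# 6) (# 7)))

  polar : V → V → Carrier
  polar u v = pairSum (λ i j → u i * v j + u j * v i)

  pairSum-cong : ∀ {s t} → (∀ i j → s i j ≈ t i j) → pairSum s ≈ pairSum t
  pairSum-cong s≈t = +-cong (s≈t _ _) (+-cong (s≈t _ _) (+-cong (s≈t _ _) (s≈t _ _)))

  pairSum-+ : ∀ s t → pairSum (λ i j → s i j + t i j) ≈ pairSum s + pairSum t
  pairSum-+ s t = trans (+-congˡ (trans (+-congˡ (interchange _ _ _ _)) (interchange _ _ _ _)))
                        (interchange _ _ _ _)

  pairSum-* : ∀ k t → pairSum (λ i j → k * t i j) ≈ k * pairSum t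
  pairSum-* k t = sym (trans (distribˡ k _ _) (+-congˡ (trans (distribˡ k _ _) (+-congˡ (distribˡ k _ _)))))

  Qf-cong : ∀ {u v} → u ≈ᵥ v → Qf u ≈ Qf v
  Qf-cong u≈v = pairSum-cong (λ i j → *-cong (u≈v i) (u≈v j))

  polar-cong : ∀ {u u' v v'} → u ≈ᵥ u' → v ≈ᵥ v' → polar u v ≈ polar u' v'
  polar-cong u≈u' v≈v' =
    pairSum-cong (λ i j → +-cong (*-cong (u≈u' i) (v≈v' j)) (*-cong (u≈u' j) (v≈v' i)))

  polar-sym : ∀ u v → polar u v ≈ polar v u
  polar-sym u v = pairSum-cong (λ i j → trans (+-comm _ _) (+-cong (*-comm (u j) (v i)) (*-comm (u i) (v j))))

  Qf-+ : ∀ u v → Qf (u +ᵥ v) ≈ (Qf u + Qf v) + polar u v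
  Qf-+ u v = begin
    Qf (u +ᵥ v)
      ≈⟨ pairSum-cong (λ i j → expand (u i) (u j) (v i) (v j)) ⟩
    pairSum (λ i j → (u i * u j + v i * v j) + (u i * v j + u j * v i))
      ≈⟨ pairSum-+ (λ i j → u i * u j + v i * v j) (λ i j → u i * v j + u j * v i) ⟩
    pairSum (λ i j → u i * u j + v i * v j) + polar u v
      ≈⟨ +-congʳ (pairSum-+ (λ i j → u i * u j) (λ i j → v i * v j)) ⟩
    (Qf u + Qf v) + polar u v ∎
    where
    expand : ∀ x x' y y' → (x + y) * (x' + y') ≈ (x * x' + y * y') + (x * y' + x' * y)
    expand = solve 4 (λ x x' y y' → (x :+ y) :* (x' :+ y') := (x :* x' :+ y :* y') :+ (x :* y' :+ x' :* y)) refl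

  Qf-· : ∀ k u → Qf (k · u) ≈ (k * k) * Qf u
  Qf-· k u = trans (pairSum-cong (λ i j → regroup (u i) (u j))) (pairSum-* (k * k) (λ i j → u i * u j))
    where
    regroup : ∀ x x' → (k * x) * (k * x') ≈ (k * k) * (x * x')
    regroup = solve 3 (λ k x x' → (k :* x) :* (k :* x') := (k :* k) :* (x :* x')) refl k

  polar-self : ∀ u → polar u u ≈ Qf u + Qf u
  polar-self u = trans (pairSum-cong (λ i j → +-congˡ {u i * u j} (*-comm (u j) (u i))))
                      (pairSum-+ (λ i j → u i * u j) (λ i j → u i * u j))

  polar-+ʳ : ∀ u v w → polar u (v +ᵥ w) ≈ polar u v + polar u w
  polar-+ʳ u v w = trans (pairSum-cong (λ i j → expand (u i) (u j) (v i) (v j) (w i) (w j))) 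
                         (pairSum-+ (λ i j → u i * v j + u j * v i) (λ i j → u i * w j + u j * w i))
    where
    expand : ∀ x x' y y' z z' → x * (y' + z') + x' * (y + z) ≈ (x * y' + x' * y) + (x * z' + x' * z)
    expand = solve 6 (λ x x' y y' z z' →
      x :* (y' :+ z') :+ x' :* (y :+ z) := (x :* y' :+ x' :* y) :+ (x :* z' :+ x' :* z)) refl

  polar-·ʳ : ∀ k u v → polar u (k · v) ≈ k * polar u v
  polar-·ʳ k u v = trans (pairSum-cong (λ i j → regroup (u i) (u j) (v i) (v j)))
                         (pairSum-* k (λ i j → u i * v j + u j * v i))
    where
    regroup : ∀ x x' y y' → x * (k * y') + x' * (k * y) ≈ k * (x * y' + x' * y)
    regroup = solve 5 (λ k x x' y y' → x :* (k :* y') :+ x' :* (k :* y) := k :* (x :* y' :+ x' :* y)) refl k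

  polar-·ˡ : ∀ k u v → polar (k · u) v ≈ k * polar u v
  polar-·ˡ k u v = begin
    polar (k · u) v ≈⟨ polar-sym (k · u) v ⟩
    polar v (k · u) ≈⟨ polar-·ʳ k v u ⟩
    k * polar v u   ≈⟨ *-congˡ (polar-sym v u) ⟩
    k * polar u v   ∎

  polar-combinationʳ : ∀ a b u v w → polar u ((a · v) +ᵥ (b · w)) ≈ a * polar u v + b * polar u w
  polar-combinationʳ a b u v w = trans (polar-+ʳ u (a · v) (b · w)) (+-cong (polar-·ʳ a u v) (polar-·ʳ b u w))

  polar-combinationˡ : ∀ a b u v w → polar ((a · u) +ᵥ (b · v)) w ≈ a * polar u w + b * polar v w
  polar-combinationˡ a b u v w = begin
    polar ((a · u) +ᵥ (b · v)) w  ≈⟨ polar-sym ((a · u) +ᵥ (b · v)) w ⟩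
    polar w ((a · u) +ᵥ (b · v))  ≈⟨ polar-combinationʳ a b w u v ⟩
    a * polar w u + b * polar w v ≈⟨ +-cong (*-congˡ (polar-sym w u)) (*-congˡ (polar-sym w v)) ⟩
    a * polar u w + b * polar v w ∎

  polar-self-singular : ∀ {u} → Qf u ≈ 0# → polar u u ≈ 0#
  polar-self-singular {u} Qu≈0 = trans (polar-self u) (trans (+-cong Qu≈0 Qu≈0) (+-identityʳ 0#))

  Qf-singular-combination : ∀ {u v} a b → Qf u ≈ 0# → Qf v ≈ 0# →
                            Qf ((a · u) +ᵥ (b · v)) ≈ a * (b * polar u v)
  Qf-singular-combination {u} {v} a b Qu≈0 Qv≈0 = begin
    Qf ((a · u) +ᵥ (b · v))                             ≈⟨ Qf-+ (a · u) (b · v) ⟩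
    (Qf (a · u) + Qf (b · v)) + polar (a · u) (b · v)   ≈⟨ x≈0⇒x+y≈y Qau+Qbv≈0 ⟩
    polar (a · u) (b · v)                               ≈⟨ polar-·ˡ a u (b · v) ⟩
    a * polar u (b · v)                                 ≈⟨ *-congˡ (polar-·ʳ b u v) ⟩
    a * (b * polar u v)                                 ∎
    where
    Qau≈0 = trans (Qf-· a u) (x≈0⇒y*x≈0 Qu≈0)
    Qbv≈0 = trans (Qf-· b v) (x≈0⇒y*x≈0 Qv≈0)
    Qau+Qbv≈0 = trans (+-cong Qau≈0 Qbv≈0) (+-identityʳ 0#)

  polar-combinations-orthogonal : ∀ {X Y Z} a₀ a₁ b₀ b₁ → Qf X ≈ 0# → polar X Y ≈ 0# → polar X Z ≈ 0# →
    polar ((a₀ · X) +ᵥ (a₁ · Y)) ((b₀ · X) +ᵥ (b₁ · Z)) ≈ a₁ * (b₁ * polar Y Z)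
  polar-combinations-orthogonal {X} {Y} {Z} a₀ a₁ b₀ b₁ QX≈0 XY≈0 XZ≈0 = begin
    polar ((a₀ · X) +ᵥ (a₁ · Y)) B   ≈⟨ polar-combinationˡ a₀ a₁ X Y B ⟩
    a₀ * polar X B + a₁ * polar Y B  ≈⟨ x≈0⇒x+y≈y (x≈0⇒y*x≈0 XB≈0) ⟩
    a₁ * polar Y B                   ≈⟨ *-congˡ (trans (polar-combinationʳ b₀ b₁ Y X Z) (x≈0⇒x+y≈y YX≈0)) ⟩
    a₁ * (b₁ * polar Y Z)            ∎
    where
    B = (b₀ · X) +ᵥ (b₁ · Z)
    XB≈0 : polar X B ≈ 0#
    XB≈0 = trans (polar-combinationʳ b₀ b₁ X X Z)
                 (trans (+-cong (x≈0⇒y*x≈0 (polar-self-singular {X} QX≈0)) (x≈0⇒y*x≈0 XZ≈0)) (+-identityʳ 0#))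
    YX≈0 : b₀ * polar Y X ≈ 0#
    YX≈0 = x≈0⇒y*x≈0 (trans (polar-sym Y X) XY≈0)

  polar-vanishes : ∀ {n} {b : Fin n → V} → TotallySingular b →
                   ∀ {u v} → InSpan b u → InSpan b v → polar u v ≈ 0#
  polar-vanishes singular {u} {v} u∈b v∈b = begin
    polar u v                  ≈⟨ x≈0⇒x+y≈y Qu+Qv≈0 ⟨
    (Qf u + Qf v) + polar u v  ≈⟨ Qf-+ u v ⟨
    Qf (u +ᵥ v)                ≈⟨ singular (u +ᵥ v) (InSpan-+ u∈b v∈b) ⟩
    0#                         ∎
    where
    Qu+Qv≈0 = trans (+-cong (singular u u∈b) (singular v v∈b)) (+-identityʳ 0#)

  secant⇒¬TotallySingular : ∀ {n} {b : Fin n → V} → MeetsQInTwoPoints b → ¬ TotallySingular b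
  secant⇒¬TotallySingular (X , Y , (X≢0 , X∈b) , _ , (_ , Y∈b) , _ , X≁Y , onlyXY) singular =
    [ (λ { (k , X+Y≈kX) → X≁Y (X+Y≈kX⇒SamePoint X+Y≈kX) })
    , (λ { (k , X+Y≈kY) →
           X≁Y (SamePoint-sym X≢0 (X+Y≈kX⇒SamePoint (λ i → trans (+-comm _ _) (X+Y≈kY i)))) })
    ]′ (onlyXY (X +ᵥ Y) (X+Y≢0 , X+Y∈b) (singular (X +ᵥ Y) X+Y∈b))
    where
    X+Y∈b = InSpan-+ X∈b Y∈b
    X+Y≢0 : NonZero (X +ᵥ Y)
    X+Y≢0 X+Y≈0 = X≁Y (X+Y≈kX⇒SamePoint {k = 0#} λ i → trans (X+Y≈0 i) (sym (zeroˡ (X i))))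

  polar≈0⇒TotallySingular : ∀ {X Y} → Qf X ≈ 0# → Qf Y ≈ 0# → polar X Y ≈ 0# → TotallySingular (pair X Y)
  polar≈0⇒TotallySingular {X} {Y} QX≈0 QY≈0 XY≈0 v (a , v≈lin) = begin
    Qf v                          ≈⟨ Qf-cong (λ i → trans (v≈lin i) (lin-pair a X Y i)) ⟩
    Qf ((a 0F · X) +ᵥ (a 1F · Y)) ≈⟨ Qf-singular-combination {X} {Y} (a 0F) (a 1F) QX≈0 QY≈0 ⟩
    a 0F * (a 1F * polar X Y)     ≈⟨ x≈0⇒y*x≈0 (x≈0⇒y*x≈0 XY≈0) ⟩
    0#                            ∎

  TotallySingular⇒polar≈0 : ∀ {X Y} → Qf X ≈ 0# → Qf Y ≈ 0# → TotallySingular (pair X Y) → polar X Y ≈ 0#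
  TotallySingular⇒polar≈0 {X} {Y} QX≈0 QY≈0 singular = begin
    polar X Y                     ≈⟨ trans (*-identityˡ _) (*-identityˡ _) ⟨
    1# * (1# * polar X Y)         ≈⟨ Qf-singular-combination {X} {Y} 1# 1# QX≈0 QY≈0 ⟨
    Qf ((1# · X) +ᵥ (1# · Y))     ≈⟨ singular _ (InSpan-pair 1# 1#) ⟩
    0#                            ∎

  secant⇒polar≉0 : ∀ {X Y} → Qf X ≈ 0# → Qf Y ≈ 0# → MeetsQInTwoPoints (pair X Y) → ¬ polar X Y ≈ 0#
  secant⇒polar≉0 {X} {Y} QX≈0 QY≈0 secant XY≈0 =
    secant⇒¬TotallySingular {b = pair X Y} secant (polar≈0⇒TotallySingular QX≈0 QY≈0 XY≈0)

module Independence {c ℓ} (F : Field c ℓ) (_≟_ : Decidable (Field._≈_ F)) where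
  open Field F hiding (zero)
  open Geometry F
  open FieldProperties F
  open VectorProperties F
  open PolarForm F
  open import Algebra.Properties.Ring ring using (-‿distribˡ-*)
  open import Algebra.Properties.Group +-group using (inverseʳ-unique)
  open import Relation.Binary.Reasoning.Setoid setoid

  k·u≈0⇒k≈0 : ∀ {k u} → NonZero u → (k · u) ≈ᵥ (λ _ → 0#) → k ≈ 0#
  k·u≈0⇒k≈0 {k} u≢0 ku≈0 = decidable-stable (k ≟ 0#) λ k≉0 → u≢0 λ i → x*y≈0⇒y≈0 k≉0 (ku≈0 i)

  independent-pair : ∀ {X Y α β} → NonZero X → ¬ SamePoint X Y →
                     (α · X) +ᵥ (β · Y) ≈ᵥ (λ _ → 0#) → α ≈ 0# × β ≈ 0#
  independent-pair {X} {Y} {α} {β} X≢0 X≁Y αX+βY≈0 = α≈0 , β≈0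
    where
    βY≈-αX : ∀ i → β * Y i ≈ - α * X i
    βY≈-αX i = trans (inverseʳ-unique _ _ (αX+βY≈0 i)) (-‿distribˡ-* α (X i))
    β≉0⇒X∼Y : ¬ β ≈ 0# → SamePoint X Y
    β≉0⇒X∼Y β≉0 = β⁻¹ * - α , λ i → begin
      Y i                 ≈⟨ β⁻¹-cancel (Y i) ⟨
      β⁻¹ * (β * Y i)     ≈⟨ *-congˡ (βY≈-αX i) ⟩
      β⁻¹ * (- α * X i)   ≈⟨ *-assoc β⁻¹ (- α) (X i) ⟨
      β⁻¹ * - α * X i     ∎
      where
      β⁻¹ = proj₁ (inverse-cancel β≉0)
      β⁻¹-cancel = proj₂ (inverse-cancel β≉0)
    β≈0 : β ≈ 0#
    β≈0 = decidable-stable (β ≟ 0#) λ β≉0 → X≁Y (β≉0⇒X∼Y β≉0)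
    α≈0 : α ≈ 0#
    α≈0 = k·u≈0⇒k≈0 X≢0 λ i →
      trans (sym (trans (+-congˡ (x≈0⇒x*y≈0 β≈0)) (+-identityʳ _))) (αX+βY≈0 i)

  LinIndep-triple : ∀ {X Y Z} → NonZero X → Qf X ≈ 0# → ¬ SamePoint X Y →
                    polar X Y ≈ 0# → ¬ polar X Z ≈ 0# → LinIndep (triple X Y Z)
  LinIndep-triple {X} {Y} {Z} X≢0 QX≈0 X≁Y XY≈0 XZ≉0 a lin≈0 =
    λ { zero → proj₁ αβ≈0 ; (suc zero) → proj₂ αβ≈0 ; (suc (suc zero)) → γ≈0 }
    where
    α = a 0F
    β = a 1F
    γ = a 2F
    comb≈0 : (α · X) +ᵥ ((β · Y) +ᵥ (γ · Z)) ≈ᵥ (λ _ → 0#)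
    comb≈0 i = trans (sym (lin-triple a X Y Z i)) (lin≈0 i)
    γXZ≈0 : γ * polar X Z ≈ 0#
    γXZ≈0 = begin
      γ * polar X Z
        ≈⟨ x≈0⇒x+y≈y (x≈0⇒y*x≈0 XY≈0) ⟨
      β * polar X Y + γ * polar X Z
        ≈⟨ x≈0⇒x+y≈y (x≈0⇒y*x≈0 (polar-self-singular {X} QX≈0)) ⟨
      α * polar X X + (β * polar X Y + γ * polar X Z)
        ≈⟨ +-cong (polar-·ʳ α X X) (polar-combinationʳ β γ X Y Z) ⟨
      polar X (α · X) + polar X ((β · Y) +ᵥ (γ · Z))
        ≈⟨ polar-+ʳ X (α · X) ((β · Y) +ᵥ (γ · Z)) ⟨
      polar X ((α · X) +ᵥ ((β · Y) +ᵥ (γ · Z)))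
        ≈⟨ polar-cong {X} (λ _ → refl) (λ i → trans (comb≈0 i) (sym (zeroˡ (X i)))) ⟩
      polar X (0# · X)
        ≈⟨ polar-·ʳ 0# X X ⟩
      0# * polar X X
        ≈⟨ zeroˡ _ ⟩
      0# ∎
    γ≈0 : γ ≈ 0#
    γ≈0 = x*y≈0⇒x≈0 XZ≉0 γXZ≈0
    αβ≈0 : α ≈ 0# × β ≈ 0#
    αβ≈0 = independent-pair X≢0 X≁Y λ i →
      trans (+-congˡ (sym (trans (+-congˡ (x≈0⇒x*y≈0 γ≈0)) (+-identityʳ _)))) (comb≈0 i)

module GeneratorGeometry {c ℓ} (F : Field c ℓ) (_≟_ : Decidable (Field._≈_ F))
                         (Π : Geometry.Generator F) where
  open Field F hiding (zero)
  open Geometry F hiding (_∼₁_; _∼₂_; Vertex)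
  open Generator Π
  open FieldProperties F
  open VectorProperties F
  open PolarForm F
  open Independence F _≟_
  open import Algebra.Solver.Ring.NaturalCoefficients.Default commutativeSemiring
  open import Relation.Binary.Reasoning.Setoid setoid

  infix 4 _∼₁_ _∼₂_
  _∼₁_ _∼₂_ : V → V → Set (c ⊔ ℓ)
  _∼₁_ = Geometry._∼₁_ F Π
  _∼₂_ = Geometry._∼₂_ F Π

  Vertex : V → Set (c ⊔ ℓ)
  Vertex = Geometry.Vertex F Π

  ∼₁⇒¬∼₂ : ∀ {X Y} → X ∼₁ Y → ¬ X ∼₂ Y
  ∼₁⇒¬∼₂ {X} {Y} secant (singular , _) = secant⇒¬TotallySingular {b = pair X Y} secant singular

  only₁ : ∀ {X Y} → X ∼₁ Y → Only₁ Π X Y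
  only₁ X∼₁Y = X∼₁Y , ∼₁⇒¬∼₂ X∼₁Y

  only₂ : ∀ {X Y} → X ∼₂ Y → Only₂ Π X Y
  only₂ X∼₂Y = X∼₂Y , λ X∼₁Y → ∼₁⇒¬∼₂ X∼₁Y X∼₂Y

  ∼₂-sym : ∀ {X Y} → X ∼₂ Y → Y ∼₂ X
  ∼₂-sym {X} {Y} (singular , meets) =
    TotallySingular-permute {b = pair X Y} (transpose 0F 1F) singular ,
    MeetsInOnePoint-permute {b = pair X Y} (transpose 0F 1F) {c = basis} meets

  ∼₁⇒polar≉0 : ∀ {X Y} → Vertex X → Vertex Y → X ∼₁ Y → ¬ polar X Y ≈ 0#
  ∼₁⇒polar≉0 {X} {Y} (_ , QX≈0 , _) (_ , QY≈0 , _) = secant⇒polar≉0 {X} {Y} QX≈0 QY≈0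

  ∼₂⇒polar≈0 : ∀ {X Y} → Vertex X → Vertex Y → X ∼₂ Y → polar X Y ≈ 0#
  ∼₂⇒polar≈0 {X} {Y} (_ , QX≈0 , _) (_ , QY≈0 , _) (singular , _) =
    TotallySingular⇒polar≈0 {X} {Y} QX≈0 QY≈0 singular

  ∼₂-∼₂⇒polar≈0 : ∀ {X Y Z} → Vertex X → Vertex Y → Vertex Z → X ∼₂ Y → X ∼₂ Z → polar Y Z ≈ 0#
  ∼₂-∼₂⇒polar≈0 {X} {Y} {Z} vX@(_ , QX≈0 , X∉Π) vY vZ
                XY@(_ , A , (A≢0 , (a , A≈lin)) , A∈Π , _) XZ@(_ , B , (B≢0 , (b , B≈lin)) , B∈Π , _) =
    x*y≈0⇒y≈0 b₁≉0 (x*y≈0⇒y≈0 a₁≉0 (begin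
      a 1F * (b 1F * polar Y Z)
        ≈⟨ polar-combinations-orthogonal {X} {Y} {Z} (a 0F) (a 1F) (b 0F) (b 1F)
             QX≈0 (∼₂⇒polar≈0 vX vY XY) (∼₂⇒polar≈0 vX vZ XZ) ⟨
      polar ((a 0F · X) +ᵥ (a 1F · Y)) ((b 0F · X) +ᵥ (b 1F · Z))
        ≈⟨ polar-cong A≈ B≈ ⟨
      polar A B
        ≈⟨ polar-vanishes {b = basis} contained A∈Π B∈Π ⟩
      0# ∎))
    where
    A≈ : A ≈ᵥ (a 0F · X) +ᵥ (a 1F · Y)
    A≈ i = trans (A≈lin i) (lin-pair a X Y i)
    B≈ : B ≈ᵥ (b 0F · X) +ᵥ (b 1F · Z)
    B≈ i = trans (B≈lin i) (lin-pair b X Z i)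
    a₁≉0 = InSpan-combination⇒coefficient≉0 {b = basis} X∉Π A≢0 A∈Π A≈
    b₁≉0 = InSpan-combination⇒coefficient≉0 {b = basis} X∉Π B≢0 B∈Π B≈

  ∼₂-∼₂⇒¬∼₁ : ∀ {X Y Z} → Vertex X → Vertex Y → Vertex Z → X ∼₂ Y → X ∼₂ Z → ¬ Y ∼₁ Z
  ∼₂-∼₂⇒¬∼₁ vX vY vZ XY XZ YZ = ∼₁⇒polar≉0 vY vZ YZ (∼₂-∼₂⇒polar≈0 vX vY vZ XY XZ)

  -- a₁ U - y A lies in Π and on the secant line XZ, whose only singular points are X and Z.
  Z-coefficient≉0⇒Z∈Π : ∀ {X Y Z A U a₀ a₁ x y z} → Qf X ≈ 0# → Qf Z ≈ 0# → ¬ polar X Z ≈ 0# →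
    InSpan basis A → A ≈ᵥ (a₀ · X) +ᵥ (a₁ · Y) → ¬ a₁ ≈ 0# →
    InSpan basis U → U ≈ᵥ (x · X) +ᵥ ((y · Y) +ᵥ (z · Z)) → ¬ z ≈ 0# → InSpan basis Z
  Z-coefficient≉0⇒Z∈Π {X} {Y} {Z} {A} {U} {a₀} {a₁} {x} {y} {z} QX≈0 QZ≈0 XZ≉0 A∈Π A≈ a₁≉0 U∈Π U≈ z≉0 =
    InSpan-unscale {b = basis} w≉0 (InSpan-resp {b = basis} W≈wZ W∈Π)
    where
    u = a₁ * x + - y * a₀
    w = a₁ * z
    W = (a₁ · U) +ᵥ ((- y) · A)
    W∈Π : InSpan basis W
    W∈Π = InSpan-+ {b = basis} (InSpan-· {b = basis} a₁ U∈Π) (InSpan-· {b = basis} (- y) A∈Π)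
    regroup : ∀ a₀ a₁ x y z X Y Z y' → a₁ * (x * X + (y * Y + z * Z)) + y' * (a₀ * X + a₁ * Y) ≈
                                       ((a₁ * x + y' * a₀) * X + (a₁ * z) * Z) + a₁ * Y * (y + y')
    regroup = solve 9 (λ a₀ a₁ x y z X Y Z y' →
      a₁ :* (x :* X :+ (y :* Y :+ z :* Z)) :+ y' :* (a₀ :* X :+ a₁ :* Y) :=
      ((a₁ :* x :+ y' :* a₀) :* X :+ (a₁ :* z) :* Z) :+ a₁ :* Y :* (y :+ y')) refl
    W≈uX+wZ : W ≈ᵥ (u · X) +ᵥ (w · Z)
    W≈uX+wZ i = begin
      a₁ * U i + - y * A i
        ≈⟨ +-cong (*-congˡ (U≈ i)) (*-congˡ (A≈ i)) ⟩
      a₁ * (x * X i + (y * Y i + z * Z i)) + - y * (a₀ * X i + a₁ * Y i)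
        ≈⟨ regroup a₀ a₁ x y z (X i) (Y i) (Z i) (- y) ⟩
      (u * X i + w * Z i) + a₁ * Y i * (y + - y)
        ≈⟨ +-congˡ (x≈0⇒y*x≈0 (-‿inverseʳ y)) ⟩
      (u * X i + w * Z i) + 0#
        ≈⟨ +-identityʳ _ ⟩
      u * X i + w * Z i ∎
    w≉0 : ¬ w ≈ 0#
    w≉0 = x≉0∧y≉0⇒x*y≉0 a₁≉0 z≉0
    u≈0 : u ≈ 0#
    u≈0 = x*y≈0⇒x≈0 (x≉0∧y≉0⇒x*y≉0 w≉0 XZ≉0) (begin
      u * (w * polar X Z)     ≈⟨ Qf-singular-combination {X} {Z} u w QX≈0 QZ≈0 ⟨
      Qf ((u · X) +ᵥ (w · Z)) ≈⟨ Qf-cong W≈uX+wZ ⟨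
      Qf W                    ≈⟨ contained W W∈Π ⟩
      0#                      ∎)
    W≈wZ : W ≈ᵥ w · Z
    W≈wZ i = trans (W≈uX+wZ i) (x≈0⇒x+y≈y (x≈0⇒x*y≈0 u≈0))

  meetsΠInOnePoint : ∀ {X Y Z} → Vertex X → Vertex Z → ¬ polar X Z ≈ 0# → X ∼₂ Y →
                     MeetsInOnePoint (triple X Y Z) basis
  meetsΠInOnePoint {X} {Y} {Z} (_ , QX≈0 , X∉Π) (_ , QZ≈0 , Z∉Π) XZ≉0
                   (_ , A , (A≢0 , (a , A≈lin)) , A∈Π , unique) =
    A , (A≢0 , (a 0F ∷ a 1F ∷ 0# ∷ []) , A∈plane) , A∈Π ,
    λ U (U≢0 , (t , U≈lin)) U∈Π → unique U (U≢0 , (t 0F ∷ t 1F ∷ []) , U∈line t U∈Π U≈lin) U∈Π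
    where
    A≈ : A ≈ᵥ (a 0F · X) +ᵥ (a 1F · Y)
    A≈ i = trans (A≈lin i) (lin-pair a X Y i)
    A∈plane : A ≈ᵥ lin (a 0F ∷ a 1F ∷ 0# ∷ []) (triple X Y Z)
    A∈plane i = trans (A≈lin i) (+-congˡ (+-congˡ (sym (trans (+-identityʳ _) (zeroˡ (Z i))))))
    U∈line : ∀ {U} t → InSpan basis U → U ≈ᵥ lin t (triple X Y Z) → U ≈ᵥ lin (t 0F ∷ t 1F ∷ []) (pair X Y)
    U∈line t U∈Π U≈lin i = trans (U≈lin i) (+-congˡ (+-congˡ (trans (+-identityʳ _) (x≈0⇒x*y≈0 t₂≈0))))
      where
      t₂≈0 : t 2F ≈ 0#
      t₂≈0 = decidable-stable (t 2F ≟ 0#) λ t₂≉0 → Z∉Π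
        (Z-coefficient≉0⇒Z∈Π {X} {Y} {Z} QX≈0 QZ≈0 XZ≉0 A∈Π A≈
          (InSpan-combination⇒coefficient≉0 {b = basis} X∉Π A≢0 A∈Π A≈)
          U∈Π (λ i → trans (U≈lin i) (lin-triple t X Y Z i)) t₂≉0)

  planeMeetingΠInPoint : ∀ {X Y Z} → Vertex X → Vertex Y → Vertex Z →
    ¬ SamePoint X Y → X ∼₂ Y → ¬ polar X Z ≈ 0# → PlaneMeetingΠInPoint Π X Y Z
  planeMeetingΠInPoint vX@(X≢0 , QX≈0 , _) vY vZ X≁Y XY XZ≉0 =
    LinIndep-triple X≢0 QX≈0 X≁Y (∼₂⇒polar≈0 vX vY XY) XZ≉0 , meetsΠInOnePoint vX vZ XZ≉0 XY

  planeMeetingΠInPoint-swap₂₃ : ∀ {P Q R} → PlaneMeetingΠInPoint Π P R Q → PlaneMeetingΠInPoint Π P Q R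
  planeMeetingΠInPoint-swap₂₃ {P} {Q} {R} =
    map (LinIndep-permute {b = triple P R Q} (transpose 1F 2F))
        (MeetsInOnePoint-permute {b = triple P R Q} (transpose 1F 2F) {c = basis})

  planeMeetingΠInPoint-rotate : ∀ {P Q R} → PlaneMeetingΠInPoint Π Q R P → PlaneMeetingΠInPoint Π P Q R
  planeMeetingΠInPoint-rotate {P} {Q} {R} =
    map (LinIndep-permute {b = triple Q R P} σ) (MeetsInOnePoint-permute {b = triple Q R P} σ {c = basis})
    where
    σ = transpose 1F 2F ∘ₚ transpose 0F 2F

  mixed-clique : ∀ {P Q R} → Clique3 Π P Q R → MixedType Π P Q R →
                 TwoOneSplit Π P Q R × PlaneMeetingΠInPoint Π P Q R
  mixed-clique {P} {Q} (vP , vQ , vR , (P≁Q , PQ) , (P≁R , PR) , (Q≁R , QR)) (not-type₁ , not-type₂)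
    with PQ | PR | QR
  ... | inj₁ PQ₁ | inj₁ PR₁ | inj₁ QR₁ = ⊥-elim (not-type₁ (PQ₁ , PR₁ , QR₁))
  ... | inj₂ PQ₂ | inj₂ PR₂ | inj₂ QR₂ = ⊥-elim (not-type₂ (PQ₂ , PR₂ , QR₂))
  ... | inj₂ PQ₂ | inj₂ PR₂ | inj₁ QR₁ = ⊥-elim (∼₂-∼₂⇒¬∼₁ vP vQ vR PQ₂ PR₂ QR₁)
  ... | inj₂ PQ₂ | inj₁ PR₁ | inj₂ QR₂ = ⊥-elim (∼₂-∼₂⇒¬∼₁ vQ vP vR (∼₂-sym PQ₂) QR₂ PR₁)
  ... | inj₁ PQ₁ | inj₂ PR₂ | inj₂ QR₂ = ⊥-elim (∼₂-∼₂⇒¬∼₁ vR vP vQ (∼₂-sym PR₂) (∼₂-sym QR₂) PQ₁)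
  ... | inj₂ PQ₂ | inj₁ PR₁ | inj₁ QR₁ =
    inj₁ (only₂ PQ₂ , only₁ PR₁ , only₁ QR₁) ,
    planeMeetingΠInPoint vP vQ vR P≁Q PQ₂ (∼₁⇒polar≉0 vP vR PR₁)
  ... | inj₁ PQ₁ | inj₂ PR₂ | inj₁ QR₁ =
    inj₂ (inj₁ (only₁ PQ₁ , only₂ PR₂ , only₁ QR₁)) ,
    planeMeetingΠInPoint-swap₂₃ (planeMeetingΠInPoint vP vR vQ P≁R PR₂ (∼₁⇒polar≉0 vP vQ PQ₁))
  ... | inj₁ PQ₁ | inj₁ PR₁ | inj₂ QR₂ =
    inj₂ (inj₂ (only₁ PQ₁ , only₁ PR₁ , only₂ QR₂)) ,
    planeMeetingΠInPoint-rotate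
      (planeMeetingΠInPoint vQ vR vP Q≁R QR₂ (∼₁⇒polar≉0 vP vQ PQ₁ ∘ trans (polar-sym P Q)))

lemma4p10 : ∀ {c ℓ : Level} (F : Field c ℓ) (q : ℕ) → IsPrimePower q → HasOrder F q →
    (Π : Geometry.Generator F) → ∀ P Q R →
    Geometry.Clique3 F Π P Q R → Geometry.MixedType F Π P Q R →
    Geometry.TwoOneSplit F Π P Q R × Geometry.PlaneMeetingΠInPoint F Π P Q R
lemma4p10 F _ _ order Π _ _ _ = GeneratorGeometry.mixed-clique F (HasOrder⇒≈-decidable order) Π
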